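{- Let $p$ be an odd prime and $a=\overline{(a_k)}_{k\in\mathbb{N}}\in\mathbb{Z}_p^\times$. The map $(\mathcal{E}_p,+)\to(\mathbb{Z}_p^\times,\cdot)$, $\alpha\mapsto a^\alpha$, is a group homomorphism. Moreover, it is an isomorphism if and only if $a_2$ is a primitive root modulo $p^2$.
   Context: $\mathbb{Z}_p$ is modeled as the set of sequences $(a_k)_{k\in\mathbb{N}}$ of integers with $a_{k+1}\equiv a_k\pmod{p^k}$ for all $k$, modulo $a_k\equiv b_k\pmod{p^k}$ for all $k$, with coordinatewise operations; units are the classes with $p\nmid a_1$. $\mathcal{E}_p$ is the set of sequences $(\alpha_k)_{k\in\mathbb{N}}$ of integers with $\alpha_{k+1}\equiv\alpha_k\pmod{\varphi(p^k)}$, modulo $\alpha_k\equiv\beta_k\pmod{\varphi(p^k)}$ for all $k$, with coordinatewise operations ($\varphi$ = Euler's totient). For $a=\overline{(a_k)}\in\mathbb{Z}_p^\times$ and $\alpha=\overline{(\alpha_k)}\in\mathcal{E}_p$, $a^\alpha:=\overline{(a_k^{\alpha_k})}\in\mathbb{Z}_p^\times$. -}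

module Defs where

open import Data.Nat as ℕ using (ℕ; zero; suc; _≤_; _<_)
open import Data.Nat.Coprimality using (coprime?; Coprime)
open import Data.Nat.Primality using (Prime)
open import Data.Integer as ℤ using (ℤ; +_; _-_; _*_; _+_; _%ℕ_)
open import Data.Integer.Divisibility using (_∣_)
open import Data.List using (List; length; filter; map; upTo)
open import Data.Product using (_×_; Σ)
open import Relation.Binary.PropositionalEquality using (_≡_)
open import Relation.Nullary using (¬_)

φ : ℕ → ℕ
φ n = length (filter (λ m → coprime? m n) (map suc (upTo n)))

infix 4 _≡_[mod_] _≈Z[_]_ _≈E[_]_
_≡_[mod_] : ℤ → ℤ → ℕ → Set
x ≡ y [mod n ] = (+ n) ∣ (x - y)

-- raw integer sequences; index k ∈ ℕ, only k ≥ 1 is used (index 0 is ignored)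
Seq : Set
Seq = ℕ → ℤ

-- membership in the model of ℤ_p : a_{k+1} ≡ a_k (mod p^k) for all k ≥ 1
IsZp : ℕ → Seq → Set
IsZp p a = ∀ k → a (suc (suc k)) ≡ a (suc k) [mod p ℕ.^ suc k ]

_≈Z[_]_ : Seq → ℕ → Seq → Set
a ≈Z[ p ] b = ∀ k → a (suc k) ≡ b (suc k) [mod p ℕ.^ suc k ]

IsUnitZp : ℕ → Seq → Set
IsUnitZp p a = IsZp p a × ¬ ((+ p) ∣ a 1)

-- membership in the model of 𝓔_p : α_{k+1} ≡ α_k (mod φ(p^k)) for all k ≥ 1
IsEp : ℕ → Seq → Set
IsEp p α = ∀ k → α (suc (suc k)) ≡ α (suc k) [mod φ (p ℕ.^ suc k) ]

_≈E[_]_ : Seq → ℕ → Seq → Set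
α ≈E[ p ] β = ∀ k → α (suc k) ≡ β (suc k) [mod φ (p ℕ.^ suc k) ]

_⊕_ : Seq → Seq → Seq
(α ⊕ β) k = α k + β k

_⊗_ : Seq → Seq → Seq
(a ⊗ b) k = a k * b k

-- x mod n as a natural number (with x mod 0 := 0; never used since φ(p^k) > 0)
_modN_ : ℤ → ℕ → ℕ
x modN zero    = 0
x modN (suc n) = x %ℕ suc n

-- a^α : k-th coordinate is a_k^{α_k} taken in (ℤ/p^k)^×, i.e. the exponent
-- α_k is read modulo φ(p^k) (so negative α_k are allowed, as in the paper).
pow : ℕ → Seq → Seq → Seq
pow p a α k = a k ℤ.^ (α k modN φ (p ℕ.^ k))

IsPrimitiveRoot : ℤ → ℕ → Set
IsPrimitiveRoot a n =
  Coprime (ℤ.∣ a ∣) n ×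
  (a ℤ.^ φ n ≡ + 1 [mod n ]) ×
  (∀ m → 0 < m → a ℤ.^ m ≡ + 1 [mod n ] → φ n ≤ m)

module Submission where

-- Modulo p^(k+1) only the residue of an exponent modulo φ(p^(k+1)) = (p-1)p^k matters for a unit:
-- Euler's theorem follows from Fermat's little theorem and the lifting step
-- z ≡ 1 (mod p^j) ⇒ z^p ≡ 1 (mod p^(j+1)). Hence α ↦ a^α is a well-defined homomorphism.
-- For odd p one has (1 + u p^j)^p ≡ 1 + u p^(j+1) (mod p^(j+2)), so if a₂ is a primitive root
-- modulo p² then a_k has order exactly φ(p^k) modulo p^k. The map is then injective, and it is
-- surjective because the φ(p^k) distinct powers of a_k exhaust the φ(p^k) units modulo p^k.
-- Conversely, if every unit is of the form a^α, then every unit modulo p² is a power a₂^i with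
-- i below the order of a₂, so that order is at least φ(p²).

open import Defs
open import Algebra.Bundles using (CommutativeSemiring)
open import Algebra.Structures.Biased using (isCommutativeSemiringˡ)
open import Data.Empty using (⊥; ⊥-elim)
open import Data.Fin as Fin using (Fin; toℕ; fromℕ; fromℕ<; inject₁; splitAt; join)
import Data.Fin.Properties as Fin
open import Data.Integer as ℤ using (ℤ; +_; _+_; _*_; _-_; -_)
import Data.Integer.Coprimality as ℤ
import Data.Integer.Properties as ℤ
open import Data.Integer.Divisibility using (_∣_)
import Data.Integer.Divisibility.Signed as Signed
open import Data.Integer.DivMod using (_/ℕ_; a≡a%ℕn+[a/ℕn]*n; n%ℕd<d)
open import Data.Integer.Tactic.RingSolver using (solve-∀)
open import Data.List as List using (_++_; length; filter; map; upTo)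
import Data.List.Properties as List
open import Data.Nat as ℕ using (ℕ; zero; suc; _≤_; _<_; _∸_; _^_)
import Data.Nat.Properties as ℕ
import Data.Nat.Divisibility as ℕ
open import Data.Nat.Coprimality as Coprime using (Coprime; coprime?; coprime-divisor)
open import Data.Nat.Combinatorics using (_C_; nC1≡n; nCn≡1; nCk+nC[k+1]≡[n+1]C[k+1])
open import Data.Nat.DivMod using (_%_; _/_; m%n<n; m%n≤m; m≡m%n+[m/n]*n; m/n*n≡m; m<n*o⇒m/o<n)
open import Data.Nat.Primality using (Prime; euclidsLemma; prime⇒irreducible; prime⇒nonZero; prime⇒nonTrivial)
import Data.Nat.Tactic.RingSolver as ℕ-Solver
open import Data.Product using (Σ; ∃; _×_; _,_; proj₁; proj₂)
open import Data.Sum using (_⊎_; inj₁; inj₂; [_,_]′)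
open import Data.Sum.Properties using (inj₁-injective; inj₂-injective)
open import Data.Vec.Functional using (_∷_)
open import Function using (id; _∘_)
open import Function.Bundles using (_⇔_; mk⇔)
open import Relation.Binary.Bundles using (Setoid)
open import Relation.Binary.Structures using (IsEquivalence)
open import Relation.Binary.PropositionalEquality
  using (_≡_; _≢_; refl; sym; trans; cong; cong₂; subst; subst₂; ≢-sym; module ≡-Reasoning)
import Relation.Binary.Reasoning.Setoid as SetoidReasoning
open import Relation.Nullary using (¬_; Dec; yes; no)
open import Relation.Nullary.Decidable using (map′)

-- Congruences of integers

-- A record around `_≡_[mod_]`, whose unfolding `n ∣ ∣ x - y ∣` does not let Agda infer x and y.
infix 4 _≋_[mod_]
record _≋_[mod_] (x y : ℤ) (n : ℕ) : Set where
  constructor mk≋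
  field divides : x ≡ y [mod n ]
open _≋_[mod_] public

module _ {n : ℕ} where

  ≋-fromSigned : ∀ {x y} → + n Signed.∣ (x - y) → x ≋ y [mod n ]
  ≋-fromSigned d = mk≋ (Signed.∣⇒∣ᵤ d)

  ≋-toSigned : ∀ {x y} → x ≋ y [mod n ] → + n Signed.∣ (x - y)
  ≋-toSigned (mk≋ d) = Signed.∣ᵤ⇒∣ d

  ≋-witness : ∀ {x y} (q : ℤ) → x - y ≡ q * + n → x ≋ y [mod n ]
  ≋-witness q eq = ≋-fromSigned (Signed.divides q eq)

  ≋-reflexive : ∀ {x y} → x ≡ y → x ≋ y [mod n ]
  ≋-reflexive {x} refl = ≋-witness (+ 0) (ℤ.+-inverseʳ x)

  ≋-refl : ∀ {x} → x ≋ x [mod n ]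
  ≋-refl = ≋-reflexive refl

  ≋-sym : ∀ {x y} → x ≋ y [mod n ] → y ≋ x [mod n ]
  ≋-sym {x} {y} x≋y = ≋-fromSigned (subst (+ n Signed.∣_) (negate x y) (Signed.∣m⇒∣-m (≋-toSigned x≋y)))
    where
    negate : ∀ x y → - (x - y) ≡ y - x
    negate = solve-∀

  ≋-trans : ∀ {x y z} → x ≋ y [mod n ] → y ≋ z [mod n ] → x ≋ z [mod n ]
  ≋-trans {x} {y} {z} x≋y y≋z =
    ≋-fromSigned (subst (+ n Signed.∣_) (telescope x y z) (Signed.∣m∣n⇒∣m+n (≋-toSigned x≋y) (≋-toSigned y≋z)))
    where
    telescope : ∀ x y z → (x - y) + (y - z) ≡ x - z
    telescope = solve-∀

  ≋-+ : ∀ {x y u v} → x ≋ y [mod n ] → u ≋ v [mod n ] → x + u ≋ y + v [mod n ]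
  ≋-+ {x} {y} {u} {v} x≋y u≋v =
    ≋-fromSigned (subst (+ n Signed.∣_) (regroup x y u v) (Signed.∣m∣n⇒∣m+n (≋-toSigned x≋y) (≋-toSigned u≋v)))
    where
    regroup : ∀ x y u v → (x - y) + (u - v) ≡ (x + u) - (y + v)
    regroup = solve-∀

  ≋-* : ∀ {x y u v} → x ≋ y [mod n ] → u ≋ v [mod n ] → x * u ≋ y * v [mod n ]
  ≋-* {x} {y} {u} {v} x≋y u≋v = ≋-fromSigned (subst (+ n Signed.∣_) (regroup x y u v)
    (Signed.∣m∣n⇒∣m+n (Signed.∣n⇒∣m*n u (≋-toSigned x≋y)) (Signed.∣n⇒∣m*n y (≋-toSigned u≋v))))
    where
    regroup : ∀ x y u v → u * (x - y) + y * (u - v) ≡ x * u - y * v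
    regroup = solve-∀

  ≋-^ : ∀ {x y} e → x ≋ y [mod n ] → x ℤ.^ e ≋ y ℤ.^ e [mod n ]
  ≋-^ zero    x≋y = ≋-refl
  ≋-^ (suc e) x≋y = ≋-* x≋y (≋-^ e x≋y)

  ≋-isEquivalence : IsEquivalence (λ x y → x ≋ y [mod n ])
  ≋-isEquivalence = record { refl = ≋-refl ; sym = ≋-sym ; trans = ≋-trans }

  ≋? : ∀ x y → Dec (x ≋ y [mod n ])
  ≋? x y = map′ mk≋ divides (n ℕ.∣? ℤ.∣ x - y ∣)

  ∣⇒≋0 : ∀ {x} → + n ∣ x → x ≋ + 0 [mod n ]
  ∣⇒≋0 {x} d = mk≋ (subst (+ n ∣_) (sym (ℤ.+-identityʳ x)) d)

  ≋0⇒∣ : ∀ {x} → x ≋ + 0 [mod n ] → + n ∣ x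
  ≋0⇒∣ {x} (mk≋ d) = subst (+ n ∣_) (ℤ.+-identityʳ x) d

≋-setoid : ℕ → Setoid _ _
≋-setoid n = record { isEquivalence = ≋-isEquivalence {n} }

module ≋-Reasoning (n : ℕ) = SetoidReasoning (≋-setoid n)

≋-weaken : ∀ {m n x y} → m ℕ.∣ n → x ≋ y [mod n ] → x ≋ y [mod m ]
≋-weaken m∣n (mk≋ d) = mk≋ (ℕ.∣-trans m∣n d)

≋-∣ : ∀ {m n x y} → m ℕ.∣ n → x ≋ y [mod n ] → + m ∣ y → + m ∣ x
≋-∣ {y = y} m∣n x≋y m∣y = ≋0⇒∣ (≋-trans (≋-weaken m∣n x≋y) (∣⇒≋0 {x = y} m∣y))

≋-∤ : ∀ {p} k {x y} → x ≋ y [mod p ^ suc k ] → ¬ (+ p ∣ x) → ¬ (+ p ∣ y)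
≋-∤ {p} k x≋y p∤x p∣y = p∤x (≋-∣ (ℕ.m∣m*n (p ^ k)) x≋y p∣y)

≋-modN : ∀ x n .{{_ : ℕ.NonZero n}} → x ≋ + (x modN n) [mod n ]
≋-modN x (suc n) = ≋-witness (x /ℕ suc n) (begin
  x - + r                              ≡⟨ cong (_- + r) (a≡a%ℕn+[a/ℕn]*n x (suc n)) ⟩
  + r + (x /ℕ suc n) * + suc n - + r   ≡⟨ cancel (+ r) _ ⟩
  (x /ℕ suc n) * + suc n               ∎)
  where
  open ≡-Reasoning
  r = x modN suc n
  cancel : ∀ r t → r + t - r ≡ t
  cancel = solve-∀

modN< : ∀ x n .{{_ : ℕ.NonZero n}} → x modN n < n
modN< x (suc n) = n%ℕd<d x (suc n)

ℤ-mod : ℕ → CommutativeSemiring _ _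
ℤ-mod n = record
  { isCommutativeSemiring = isCommutativeSemiringˡ record
    { +-isCommutativeMonoid = record
      { isMonoid = record
        { isSemigroup = record
          { isMagma = record { isEquivalence = ≋-isEquivalence {n} ; ∙-cong = ≋-+ }
          ; assoc = λ x y z → ≋-reflexive (ℤ.+-assoc x y z) }
        ; identity = (λ x → ≋-reflexive (ℤ.+-identityˡ x)) , (λ x → ≋-reflexive (ℤ.+-identityʳ x)) }
      ; comm = λ x y → ≋-reflexive (ℤ.+-comm x y) }
    ; *-isCommutativeMonoid = record
      { isMonoid = record
        { isSemigroup = record
          { isMagma = record { isEquivalence = ≋-isEquivalence {n} ; ∙-cong = ≋-* }
          ; assoc = λ x y z → ≋-reflexive (ℤ.*-assoc x y z) }
        ; identity = (λ x → ≋-reflexive (ℤ.*-identityˡ x)) , (λ x → ≋-reflexive (ℤ.*-identityʳ x)) }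
      ; comm = λ x y → ≋-reflexive (ℤ.*-comm x y) }
    ; distribʳ = λ x y z → ≋-reflexive (ℤ.*-distribʳ-+ x y z)
    ; zeroˡ = λ x → ≋-reflexive (ℤ.*-zeroˡ x) } }

-- Binomial coefficients and Fermat's little theorem

[k+1]*[n+1]C[k+1]≡[n+1]*nCk : ∀ n k → suc k ℕ.* (suc n C suc k) ≡ suc n ℕ.* (n C k)
[k+1]*[n+1]C[k+1]≡[n+1]*nCk n       zero    =
  trans (ℕ.*-identityˡ _) (trans (nC1≡n (suc n)) (sym (ℕ.*-identityʳ (suc n))))
[k+1]*[n+1]C[k+1]≡[n+1]*nCk zero    (suc k) = ℕ.*-zeroʳ (suc (suc k))
[k+1]*[n+1]C[k+1]≡[n+1]*nCk (suc n) (suc k) = begin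
  suc (suc k) ℕ.* (suc (suc n) C suc (suc k))  ≡⟨ cong (suc (suc k) ℕ.*_) (sym (pascal (suc n) (suc k))) ⟩
  suc (suc k) ℕ.* (X ℕ.+ Y)                    ≡⟨ split k X Y ⟩
  suc k ℕ.* X ℕ.+ X ℕ.+ suc (suc k) ℕ.* Y      ≡⟨ cong₂ (λ u v → u ℕ.+ X ℕ.+ v) ([k+1]*[n+1]C[k+1]≡[n+1]*nCk n k)
                                                                               ([k+1]*[n+1]C[k+1]≡[n+1]*nCk n (suc k)) ⟩
  suc n ℕ.* A ℕ.+ X ℕ.+ suc n ℕ.* B            ≡⟨ cong (λ u → suc n ℕ.* A ℕ.+ u ℕ.+ suc n ℕ.* B)
                                                       (sym (pascal n k)) ⟩
  suc n ℕ.* A ℕ.+ (A ℕ.+ B) ℕ.+ suc n ℕ.* B    ≡⟨ merge n A B ⟩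
  suc (suc n) ℕ.* (A ℕ.+ B)                    ≡⟨ cong (suc (suc n) ℕ.*_) (pascal n k) ⟩
  suc (suc n) ℕ.* X                            ∎
  where
  open ≡-Reasoning
  pascal = nCk+nC[k+1]≡[n+1]C[k+1]
  A = n C k
  B = n C suc k
  X = suc n C suc k
  Y = suc n C suc (suc k)
  split : ∀ k X Y → suc (suc k) ℕ.* (X ℕ.+ Y) ≡ suc k ℕ.* X ℕ.+ X ℕ.+ suc (suc k) ℕ.* Y
  split = ℕ-Solver.solve-∀
  merge : ∀ n A B → suc n ℕ.* A ℕ.+ (A ℕ.+ B) ℕ.+ suc n ℕ.* B ≡ suc (suc n) ℕ.* (A ℕ.+ B)
  merge = ℕ-Solver.solve-∀

prime∣pCk : ∀ {p k} → Prime p → 0 < k → k < p → p ℕ.∣ p C k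
prime∣pCk {suc n} {suc k} p-prime _ k<p
  with euclidsLemma (suc k) (suc n C suc k) p-prime
         (subst (suc n ℕ.∣_) (sym ([k+1]*[n+1]C[k+1]≡[n+1]*nCk n k)) (ℕ.m∣m*n (n C k)))
... | inj₁ p∣k = ⊥-elim (ℕ.<⇒≱ k<p (ℕ.∣⇒≤ p∣k))
... | inj₂ p∣C = p∣C

odd-prime∣pC2 : ∀ {p} → Prime p → p ≢ 2 → p ℕ.∣ p C 2
odd-prime∣pC2 {p} p-prime p≢2 = prime∣pCk p-prime (ℕ.s≤s ℕ.z≤n) 2<p
  where
  2<p : 2 < p
  2<p = ℕ.≤∧≢⇒< (ℕ.nonTrivial⇒n>1 p {{prime⇒nonTrivial p-prime}}) (≢-sym p≢2)

prime∣*⇒∣⊎∣ : ∀ {p} → Prime p → ∀ x y → + p ∣ x * y → + p ∣ x ⊎ + p ∣ y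
prime∣*⇒∣⊎∣ p-prime x y p∣xy = euclidsLemma ℤ.∣ x ∣ ℤ.∣ y ∣ p-prime (subst (_ ℕ.∣_) (ℤ.abs-* x y) p∣xy)

module _ (n : ℕ) where
  open CommutativeSemiring (ℤ-mod n) using (+-rawMonoid; rawSemiring)
  open import Algebra.Definitions.RawMonoid +-rawMonoid using () renaming (_×_ to _×ᴿ_)
  open import Algebra.Definitions.RawSemiring rawSemiring using () renaming (_^_ to _^ᴿ_)

  ×ᴿ≡* : ∀ m z → m ×ᴿ z ≡ + m * z
  ×ᴿ≡* zero    z = sym (ℤ.*-zeroˡ z)
  ×ᴿ≡* (suc m) z = begin
    z + m ×ᴿ z         ≡⟨ cong (λ w → z + w) (×ᴿ≡* m z) ⟩
    z + + m * z        ≡⟨ cong (_+ + m * z) (sym (ℤ.*-identityˡ z)) ⟩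
    + 1 * z + + m * z  ≡⟨ sym (ℤ.*-distribʳ-+ z (+ 1) (+ m)) ⟩
    + suc m * z        ∎
    where open ≡-Reasoning

  ^ᴿ≡^ : ∀ z m → z ^ᴿ m ≡ z ℤ.^ m
  ^ᴿ≡^ z zero    = refl
  ^ᴿ≡^ z (suc m) = cong (z *_) (^ᴿ≡^ z m)

-- The binomial theorem in ℤ-mod p, whose middle coefficients p C k vanish.
frobenius : ∀ {p} → Prime p → ∀ x y → (x + y) ℤ.^ p ≋ x ℤ.^ p + y ℤ.^ p [mod p ]
frobenius {suc q} p-prime x y = begin
  (x + y) ℤ.^ p                                       ≡⟨ sym (^ᴿ≡^ p (x + y) p) ⟩
  (x + y) ^ᴿ p                                        ≈⟨ theorem p x y ⟩
  sum t                                               ≈⟨ +-congˡ {t Fin.zero} (sum-init-last (tail t)) ⟩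
  t Fin.zero + (sum (init (tail t)) + last (tail t))  ≈⟨ +-cong (≋-reflexive first) (+-cong middle final) ⟩
  y ℤ.^ p + (+ 0 + x ℤ.^ p)                           ≡⟨ swap (y ℤ.^ p) (x ℤ.^ p) ⟩
  x ℤ.^ p + y ℤ.^ p                                   ∎
  where
  p = suc q
  open CommutativeSemiring (ℤ-mod p) using (+-cong; +-congˡ; rawSemiring; +-monoid)
  open import Algebra.Definitions.RawSemiring rawSemiring using () renaming (_^_ to _^ᴿ_)
  open import Algebra.Properties.CommutativeSemiring.Binomial (ℤ-mod p) using (theorem; binomialTerm)
  open import Algebra.Properties.Monoid.Sum +-monoid using (sum; sum-init-last; sum-cong-≋; sum-replicate-zero)
  open import Data.Vec.Functional using (tail; init; last; replicate)
  open ≋-Reasoning p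
  t = binomialTerm x y p
  term : ∀ k → t k ≡ + (p C toℕ k) * (x ℤ.^ toℕ k * y ℤ.^ (p ∸ toℕ k))
  term k = trans (×ᴿ≡* p (p C toℕ k) _)
    (cong (+ (p C toℕ k) *_) (cong₂ _*_ (^ᴿ≡^ p x (toℕ k)) (^ᴿ≡^ p y (p ∸ toℕ k))))
  first : t Fin.zero ≡ y ℤ.^ p
  first = trans (term Fin.zero) (trans (ℤ.*-identityˡ _) (ℤ.*-identityˡ _))
  final : last (tail t) ≋ x ℤ.^ p [mod p ]
  final = begin
    t (Fin.suc (fromℕ q))                          ≡⟨ term (Fin.suc (fromℕ q)) ⟩
    + (p C suc j) * (x ℤ.^ suc j * y ℤ.^ (q ∸ j))  ≡⟨ cong (λ j → + (p C suc j) * (x ℤ.^ suc j * y ℤ.^ (q ∸ j)))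
                                                          (Fin.toℕ-fromℕ q) ⟩
    + (p C p) * (x ℤ.^ p * y ℤ.^ (q ∸ q))          ≡⟨ cong₂ (λ c e → + c * (x ℤ.^ p * y ℤ.^ e))
                                                            (nCn≡1 p) (ℕ.n∸n≡0 q) ⟩
    + 1 * (x ℤ.^ p * + 1)                          ≡⟨ trans (ℤ.*-identityˡ _) (ℤ.*-identityʳ _) ⟩
    x ℤ.^ p                                        ∎
    where
    j = toℕ (fromℕ q)
  middle : sum (init (tail t)) ≋ + 0 [mod p ]
  middle = begin
    sum (init (tail t))      ≈⟨ sum-cong-≋ {q} vanishing ⟩
    sum (replicate q (+ 0))  ≈⟨ sum-replicate-zero q ⟩
    + 0                      ∎
    where
    vanishing : (i : Fin q) → t (Fin.suc (inject₁ i)) ≋ + 0 [mod p ]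
    vanishing i = begin
      t (Fin.suc (inject₁ i))  ≡⟨ term (Fin.suc (inject₁ i)) ⟩
      + (p C suc j) * w        ≈⟨ ≋-* pCj≋0 ≋-refl ⟩
      + 0 * w                  ≡⟨ ℤ.*-zeroˡ w ⟩
      + 0                      ∎
      where
      j = toℕ (inject₁ i)
      w = x ℤ.^ suc j * y ℤ.^ (q ∸ j)
      j<q : j < q
      j<q = subst (_< q) (sym (Fin.toℕ-inject₁ i)) (Fin.toℕ<n i)
      pCj≋0 : + (p C suc j) ≋ + 0 [mod p ]
      pCj≋0 = ∣⇒≋0 {x = + (p C suc j)} (prime∣pCk p-prime (ℕ.s≤s ℕ.z≤n) (ℕ.s≤s j<q))
  swap : ∀ a b → a + (+ 0 + b) ≡ b + a
  swap = solve-∀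

fermat : ∀ {p} → Prime p → ∀ x → x ℤ.^ p ≋ x [mod p ]
fermat {suc q} p-prime x = begin
  x ℤ.^ p  ≈⟨ ≋-^ p (≋-modN x p) ⟩
  r ℤ.^ p  ≈⟨ fermat-ℕ (x modN p) ⟩
  r        ≈⟨ ≋-sym (≋-modN x p) ⟩
  x        ∎
  where
  p = suc q
  r = + (x modN p)
  open ≋-Reasoning p
  fermat-ℕ : ∀ n → (+ n) ℤ.^ p ≋ + n [mod p ]
  fermat-ℕ zero    = ≋-reflexive (ℤ.*-zeroˡ ((+ 0) ℤ.^ q))
  fermat-ℕ (suc n) = begin
    (+ 1 + + n) ℤ.^ p           ≈⟨ frobenius p-prime (+ 1) (+ n) ⟩
    (+ 1) ℤ.^ p + (+ n) ℤ.^ p   ≈⟨ ≋-+ (≋-reflexive (ℤ.^-zeroˡ p)) (fermat-ℕ n) ⟩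
    + 1 + + n                   ∎

fermat-unit : ∀ {q} → Prime (suc q) → ∀ x → ¬ (+ suc q ∣ x) → x ℤ.^ q ≋ + 1 [mod suc q ]
fermat-unit {q} p-prime x p∤x = mk≋ ([ ⊥-elim ∘ p∤x , id ]′ p∣x⊎p∣x^q-1)
  where
  factor : ∀ x y → x * y - x ≡ x * (y - + 1)
  factor = solve-∀
  p∣x[x^q-1] : + suc q ∣ x * (x ℤ.^ q - + 1)
  p∣x[x^q-1] = subst (+ suc q ∣_) (factor x (x ℤ.^ q)) (divides (fermat p-prime x))
  p∣x⊎p∣x^q-1 : + suc q ∣ x ⊎ + suc q ∣ (x ℤ.^ q - + 1)
  p∣x⊎p∣x^q-1 = prime∣*⇒∣⊎∣ p-prime x (x ℤ.^ q - + 1) p∣x[x^q-1]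

-- Powers of integers congruent to 1 modulo a power of p

pow-1+-expansion : ∀ w r → ∃ λ c → (+ 1 + w) ℤ.^ r ≡ + 1 + + r * w + + (r C 2) * (w * w) + w * w * w * c
pow-1+-expansion w zero    = + 0 , expand w
  where
  expand : ∀ w → + 1 ≡ + 1 + + 0 * w + + 0 * (w * w) + w * w * w * + 0
  expand = solve-∀
pow-1+-expansion w (suc r) with pow-1+-expansion w r
... | c , eq = c + T + w * c , (begin
  (+ 1 + w) * (+ 1 + w) ℤ.^ r                                              ≡⟨ cong ((+ 1 + w) *_) eq ⟩
  (+ 1 + w) * (+ 1 + + r * w + T * (w * w) + w * w * w * c)                 ≡⟨ expand w (+ r) T c ⟩
  + 1 + + suc r * w + (T + + r) * (w * w) + w * w * w * (c + T + w * c)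
    ≡⟨ cong (λ t → + 1 + + suc r * w + t * (w * w) + w * w * w * (c + T + w * c)) T+r≡ ⟩
  + 1 + + suc r * w + + (suc r C 2) * (w * w) + w * w * w * (c + T + w * c) ∎)
  where
  open ≡-Reasoning
  T = + (r C 2)
  T+r≡ : T + + r ≡ + (suc r C 2)
  T+r≡ = cong +_ (trans (ℕ.+-comm (r C 2) r)
                   (trans (cong (ℕ._+ r C 2) (sym (nC1≡n r))) (nCk+nC[k+1]≡[n+1]C[k+1] r 1)))
  expand : ∀ w r t c → (+ 1 + w) * (+ 1 + r * w + t * (w * w) + w * w * w * c)
                     ≡ + 1 + (+ 1 + r) * w + (t + r) * (w * w) + w * w * w * (c + t + w * c)
  expand = solve-∀

pos-^ : ∀ p k → + (p ^ k) ≡ (+ p) ℤ.^ k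
pos-^ p zero    = refl
pos-^ p (suc k) = trans (ℤ.pos-* p (p ^ k)) (cong (+ p *_) (pos-^ p k))

^-monoʳ-∣ : ∀ p {m n} → m ≤ n → p ^ m ℕ.∣ p ^ n
^-monoʳ-∣ p {m} {n} m≤n = subst (λ e → p ^ m ℕ.∣ p ^ e) (ℕ.m+[n∸m]≡n m≤n)
  (subst (p ^ m ℕ.∣_) (sym (ℕ.^-distribˡ-+-* p m (n ∸ m))) (ℕ.m∣m*n (p ^ (n ∸ m))))

OneModExactly : ℕ → ℕ → ℤ → Set
OneModExactly p e z = z ≋ + 1 [mod p ^ e ] × ¬ (z ≋ + 1 [mod p ^ suc e ])

module _ (p : ℕ) where

  private
    P : ℤ
    P = + p

  ≋-witness-^ : ∀ {x y} q k → x - y ≡ q * P ℤ.^ k → x ≋ y [mod p ^ k ]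
  ≋-witness-^ q k eq = ≋-witness q (trans eq (cong (q *_) (sym (pos-^ p k))))

  ≋1⇒≡1+ : ∀ {z} k → z ≋ + 1 [mod p ^ k ] → ∃ λ u → z ≡ + 1 + u * P ℤ.^ k
  ≋1⇒≡1+ {z} k z≋1 = u , (begin
    z                    ≡⟨ split z ⟩
    + 1 + (z - + 1)      ≡⟨ cong (λ t → + 1 + t) (Signed._∣_.equality d) ⟩
    + 1 + u * + (p ^ k)  ≡⟨ cong (λ t → + 1 + u * t) (pos-^ p k) ⟩
    + 1 + u * P ℤ.^ k    ∎)
    where
    open ≡-Reasoning
    d = ≋-toSigned z≋1
    u = Signed._∣_.quotient d
    split : ∀ z → z ≡ + 1 + (z - + 1)
    split = solve-∀

  pow-1+-≋ : ∀ j u m →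
    (+ 1 + u * P ℤ.^ suc j) ℤ.^ m ≋ + 1 + + m * (u * P ℤ.^ suc j) [mod p ^ suc (suc j) ]
  pow-1+-≋ j u m = ≋-witness-^ (u * u * Q * (T + w * c)) (suc (suc j)) (begin
    (+ 1 + w) ℤ.^ m - (+ 1 + + m * w)                                ≡⟨ cong (_- (+ 1 + + m * w)) expansion ⟩
    (+ 1 + + m * w + T * (w * w) + w * w * w * c) - (+ 1 + + m * w)   ≡⟨ regroup u P Q (+ m) T c ⟩
    u * u * Q * (T + w * c) * P ℤ.^ suc (suc j)                       ∎)
    where
    open ≡-Reasoning
    Q = P ℤ.^ j
    w = u * P ℤ.^ suc j
    T = + (m C 2)
    c = proj₁ (pow-1+-expansion w m)
    expansion = proj₂ (pow-1+-expansion w m)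
    regroup : ∀ u P Q M T c →
      (+ 1 + M * (u * (P * Q)) + T * ((u * (P * Q)) * (u * (P * Q))) + (u * (P * Q)) * (u * (P * Q)) * (u * (P * Q)) * c)
        - (+ 1 + M * (u * (P * Q)))
      ≡ u * u * Q * (T + u * (P * Q) * c) * (P * (P * Q))
    regroup = solve-∀

  -- Only here does p ∣ p C 2, i.e. p odd, enter: it kills the quadratic term.
  pow-p-1+-≋ : p ℕ.∣ p C 2 → ∀ j u →
    (+ 1 + u * P ℤ.^ suc j) ℤ.^ p ≋ + 1 + u * P ℤ.^ suc (suc j) [mod p ^ suc (suc (suc j)) ]
  pow-p-1+-≋ p∣pC2 j u = ≋-witness-^ (+ t * u * u * Q + u * u * u * Q * Q * c) (suc (suc (suc j))) (begin
    (+ 1 + w) ℤ.^ p - 1+up^[2+j]                                         ≡⟨ cong (_- 1+up^[2+j]) expansion ⟩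
    rest (+ (p C 2))                                                     ≡⟨ cong rest pC2≡tP ⟩
    rest (+ t * P)                                                       ≡⟨ regroup u P Q (+ t) c ⟩
    (+ t * u * u * Q + u * u * u * Q * Q * c) * P ℤ.^ suc (suc (suc j))  ∎)
    where
    open ≡-Reasoning
    t = ℕ._∣_.quotient p∣pC2
    pC2≡tP : + (p C 2) ≡ + t * P
    pC2≡tP = trans (cong +_ (ℕ._∣_.equality p∣pC2)) (ℤ.pos-* t p)
    Q = P ℤ.^ j
    w = u * P ℤ.^ suc j
    1+up^[2+j] = + 1 + u * P ℤ.^ suc (suc j)
    c = proj₁ (pow-1+-expansion w p)
    expansion = proj₂ (pow-1+-expansion w p)
    rest : ℤ → ℤ
    rest T = (+ 1 + P * w + T * (w * w) + w * w * w * c) - 1+up^[2+j]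
    regroup : ∀ u P Q t c →
      (+ 1 + P * (u * (P * Q)) + t * P * ((u * (P * Q)) * (u * (P * Q))) + (u * (P * Q)) * (u * (P * Q)) * (u * (P * Q)) * c)
        - (+ 1 + u * (P * (P * Q)))
      ≡ (t * u * u * Q + u * u * u * Q * Q * c) * (P * (P * (P * Q)))
    regroup = solve-∀

  lift-≋1 : ∀ j {z} → z ≋ + 1 [mod p ^ suc j ] → z ℤ.^ p ≋ + 1 [mod p ^ suc (suc j) ]
  lift-≋1 j z≋1 with ≋1⇒≡1+ (suc j) z≋1
  ... | u , refl = begin
    (+ 1 + u * P ℤ.^ suc j) ℤ.^ p  ≈⟨ pow-1+-≋ j u p ⟩
    + 1 + P * (u * P ℤ.^ suc j)    ≈⟨ ≋-witness-^ u (suc (suc j)) (cancel u P (P ℤ.^ j)) ⟩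
    + 1                            ∎
    where
    open ≋-Reasoning (p ^ suc (suc j))
    cancel : ∀ u P Q → (+ 1 + P * (u * (P * Q))) - + 1 ≡ u * (P * (P * Q))
    cancel = solve-∀

module _ {p : ℕ} (p-prime : Prime p) where

  private
    P : ℤ
    P = + p
    instance
      p≢0 : ℕ.NonZero p
      p≢0 = prime⇒nonZero p-prime

  p∣u⇒1+u*p^k≋1 : ∀ k u → + p ∣ u → + 1 + u * P ℤ.^ k ≋ + 1 [mod p ^ suc k ]
  p∣u⇒1+u*p^k≋1 k u p∣u = ≋-witness-^ p v (suc k) (begin
    (+ 1 + u * P ℤ.^ k) - + 1      ≡⟨ cong (λ t → (+ 1 + t * P ℤ.^ k) - + 1) (Signed._∣_.equality d) ⟩
    (+ 1 + v * P * P ℤ.^ k) - + 1  ≡⟨ cancel v P (P ℤ.^ k) ⟩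
    v * P ℤ.^ suc k                ∎)
    where
    open ≡-Reasoning
    d = Signed.∣ᵤ⇒∣ {P} {u} p∣u
    v = Signed._∣_.quotient d
    cancel : ∀ v P Q → (+ 1 + v * P * Q) - + 1 ≡ v * (P * Q)
    cancel = solve-∀

  1+u*p^k≋1⇒p∣u : ∀ k u → + 1 + u * P ℤ.^ k ≋ + 1 [mod p ^ suc k ] → + p ∣ u
  1+u*p^k≋1⇒p∣u k u eq = Signed.∣⇒∣ᵤ {P} {u} (Signed.*-cancelʳ-∣ (P ℤ.^ k) {{p^k≢0}} p^[1+k]∣u*p^k)
    where
    p^k≢0 : ℤ.NonZero (P ℤ.^ k)
    p^k≢0 = subst ℤ.NonZero (pos-^ p k) (ℕ.m^n≢0 p k)
    cancel : ∀ u Q → (+ 1 + u * Q) - + 1 ≡ u * Q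
    cancel = solve-∀
    p^[1+k]∣u*p^k : P * P ℤ.^ k Signed.∣ u * P ℤ.^ k
    p^[1+k]∣u*p^k = subst₂ Signed._∣_ (pos-^ p (suc k)) (cancel u (P ℤ.^ k)) (≋-toSigned eq)

  lift-exact : p ≢ 2 → ∀ j {z} → OneModExactly p (suc j) z → OneModExactly p (suc (suc j)) (z ℤ.^ p)
  lift-exact p≢2 j (z≋1 , z≉1) with ≋1⇒≡1+ p (suc j) z≋1
  ... | u , refl = lift-≋1 p j z≋1 , λ z^p≋1 → z≉1 (p∣u⇒1+u*p^k≋1 (suc j) u (1+u*p^k≋1⇒p∣u (suc (suc j)) u
                     (≋-trans (≋-sym (pow-p-1+-≋ p (odd-prime∣pC2 p-prime p≢2) j u)) z^p≋1)))

  exact⇒p∣exponent : ∀ i {z} m → OneModExactly p (suc i) z → z ℤ.^ m ≋ + 1 [mod p ^ suc (suc i) ] → p ℕ.∣ m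
  exact⇒p∣exponent i m (z≋1 , z≉1) z^m≋1 with ≋1⇒≡1+ p (suc i) z≋1
  ... | u , refl = [ id , (λ p∣u → ⊥-elim (z≉1 (p∣u⇒1+u*p^k≋1 (suc i) u p∣u))) ]′
                     (prime∣*⇒∣⊎∣ p-prime (+ m) u (1+u*p^k≋1⇒p∣u (suc i) (+ m * u) 1+mu*p^[1+i]≋1))
    where
    1+mu*p^[1+i]≋1 : + 1 + + m * u * P ℤ.^ suc i ≋ + 1 [mod p ^ suc (suc i) ]
    1+mu*p^[1+i]≋1 = ≋-trans (≋-reflexive (cong (λ t → + 1 + t) (ℤ.*-assoc (+ m) u (P ℤ.^ suc i))))
                             (≋-trans (≋-sym (pow-1+-≋ p i u m)) z^m≋1)

  exact⇒p^j∣exponent : p ≢ 2 → ∀ j i {z} m → OneModExactly p (suc i) z →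
                        z ℤ.^ m ≋ + 1 [mod p ^ (j ℕ.+ suc i) ] → p ^ j ℕ.∣ m
  exact⇒p^j∣exponent p≢2 zero    i m exact z^m≋1 = ℕ.1∣ m
  exact⇒p^j∣exponent p≢2 (suc j) i {z} m exact z^m≋1 =
    subst (p ^ suc j ℕ.∣_) (sym m≡kp) (subst (ℕ._∣ k ℕ.* p) (ℕ.*-comm (p ^ j) p) (ℕ.*-monoˡ-∣ p p^j∣k))
    where
    p∣m = exact⇒p∣exponent i m exact (≋-weaken (^-monoʳ-∣ p (ℕ.s≤s (ℕ.m≤n+m (suc i) j))) z^m≋1)
    k = ℕ._∣_.quotient p∣m
    m≡kp = ℕ._∣_.equality p∣m
    [z^p]^k≋1 : (z ℤ.^ p) ℤ.^ k ≋ + 1 [mod p ^ (j ℕ.+ suc (suc i)) ]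
    [z^p]^k≋1 = subst₂ (λ x e → x ≋ + 1 [mod p ^ e ])
      (sym (trans (ℤ.^-*-assoc z p k) (cong (z ℤ.^_) (trans (ℕ.*-comm p k) (sym m≡kp)))))
      (sym (ℕ.+-suc j (suc i))) z^m≋1
    p^j∣k = exact⇒p^j∣exponent p≢2 j (suc i) k (lift-exact p≢2 i exact) [z^p]^k≋1

-- Euler's totient of a prime power

count : ℕ → ℕ → ℕ
count n N = length (filter (λ m → coprime? m n) (map suc (upTo N)))

count-suc : ∀ n N → count n (suc N) ≡ count n N ℕ.+ length (filter (λ m → coprime? m n) List.[ suc N ])
count-suc n N = begin
  length (filter P? (map suc (upTo (suc N))))                        ≡⟨ cong (λ xs → length (filter P? (map suc xs)))
                                                                            (sym (List.upTo-∷ʳ N)) ⟩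
  length (filter P? (map suc (upTo N ++ List.[ N ])))                ≡⟨ cong (λ xs → length (filter P? xs))
                                                                            (List.map-++ suc (upTo N) List.[ N ]) ⟩
  length (filter P? (map suc (upTo N) ++ List.[ suc N ]))            ≡⟨ cong length
                                                                            (List.filter-++ P? (map suc (upTo N)) List.[ suc N ]) ⟩
  length (filter P? (map suc (upTo N)) ++ filter P? List.[ suc N ])  ≡⟨ List.length-++ (filter P? (map suc (upTo N))) ⟩
  count n N ℕ.+ length (filter P? List.[ suc N ])                    ∎
  where
  open ≡-Reasoning
  P? = λ m → coprime? m n

count-accept : ∀ {n N} → Coprime (suc N) n → count n (suc N) ≡ suc (count n N)
count-accept {n} {N} c = trans (count-suc n N)
  (trans (cong (λ xs → count n N ℕ.+ length xs) (List.filter-accept (λ m → coprime? m n) c)) (ℕ.+-comm (count n N) 1))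

count-reject : ∀ {n N} → ¬ Coprime (suc N) n → count n (suc N) ≡ count n N
count-reject {n} {N} ¬c = trans (count-suc n N)
  (trans (cong (λ xs → count n N ℕ.+ length xs) (List.filter-reject (λ m → coprime? m n) ¬c)) (ℕ.+-identityʳ (count n N)))

module _ {p : ℕ} (p-prime : Prime p) where

  ∤⇒coprime-p^ : ∀ {m} k → ¬ p ℕ.∣ m → Coprime m (p ^ k)
  ∤⇒coprime-p^ zero    p∤m (_ , d∣1) = ℕ.∣1⇒≡1 d∣1
  ∤⇒coprime-p^ (suc k) p∤m (d∣m , d∣p*p^k) = ∤⇒coprime-p^ k p∤m (d∣m , coprime-divisor d⊥p d∣p*p^k)
    where
    d⊥p : Coprime _ p
    d⊥p (e∣d , e∣p) with prime⇒irreducible p-prime e∣p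
    ... | inj₁ e≡1  = e≡1
    ... | inj₂ refl = ⊥-elim (p∤m (ℕ.∣-trans e∣d d∣m))

  coprime-p^suc⇒∤ : ∀ {m} k → Coprime m (p ^ suc k) → ¬ p ℕ.∣ m
  coprime-p^suc⇒∤ k m⊥p^[1+k] p∣m =
    ℕ.nonTrivial⇒≢1 {{prime⇒nonTrivial p-prime}} (m⊥p^[1+k] (p∣m , ℕ.m∣m*n (p ^ k)))

module _ {q : ℕ} (p-prime : Prime (suc q)) where

  private
    p : ℕ
    p = suc q

  -- Of the p consecutive numbers M·p + 1, …, M·p + p only the last one is divisible by p.
  count-p^suc : ∀ k M r → r ≤ q → count (p ^ suc k) (M ℕ.* p ℕ.+ r) ≡ M ℕ.* q ℕ.+ r
  count-p^suc k zero    zero    _   = refl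
  count-p^suc k (suc M) zero    _   = begin
    count (p ^ suc k) (suc M ℕ.* p ℕ.+ 0)      ≡⟨ cong (count (p ^ suc k)) (block-end M q) ⟩
    count (p ^ suc k) (suc (M ℕ.* p ℕ.+ q))    ≡⟨ count-reject (λ c → coprime-p^suc⇒∤ p-prime k c p∣end) ⟩
    count (p ^ suc k) (M ℕ.* p ℕ.+ q)          ≡⟨ count-p^suc k M q ℕ.≤-refl ⟩
    M ℕ.* q ℕ.+ q                              ≡⟨ count-end M q ⟩
    suc M ℕ.* q ℕ.+ 0                          ∎
    where
    open ≡-Reasoning
    block-end : ∀ M q → suc M ℕ.* suc q ℕ.+ 0 ≡ suc (M ℕ.* suc q ℕ.+ q)
    block-end = ℕ-Solver.solve-∀
    count-end : ∀ M q → M ℕ.* q ℕ.+ q ≡ suc M ℕ.* q ℕ.+ 0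
    count-end = ℕ-Solver.solve-∀
    p∣end : p ℕ.∣ suc (M ℕ.* p ℕ.+ q)
    p∣end = subst (p ℕ.∣_) (block-end M q) (subst (p ℕ.∣_) (sym (ℕ.+-identityʳ _)) (ℕ.n∣m*n (suc M)))
  count-p^suc k M       (suc r) r<q = begin
    count (p ^ suc k) (M ℕ.* p ℕ.+ suc r)      ≡⟨ cong (count (p ^ suc k)) (ℕ.+-suc (M ℕ.* p) r) ⟩
    count (p ^ suc k) (suc (M ℕ.* p ℕ.+ r))    ≡⟨ count-accept (∤⇒coprime-p^ p-prime (suc k) p∤) ⟩
    suc (count (p ^ suc k) (M ℕ.* p ℕ.+ r))    ≡⟨ cong suc (count-p^suc k M r (ℕ.<⇒≤ r<q)) ⟩
    suc (M ℕ.* q ℕ.+ r)                        ≡⟨ sym (ℕ.+-suc (M ℕ.* q) r) ⟩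
    M ℕ.* q ℕ.+ suc r                          ∎
    where
    open ≡-Reasoning
    p∤ : ¬ p ℕ.∣ suc (M ℕ.* p ℕ.+ r)
    p∤ p∣ = ℕ.<⇒≱ (ℕ.s≤s r<q)
      (ℕ.∣⇒≤ (ℕ.∣m+n∣m⇒∣n (subst (p ℕ.∣_) (sym (ℕ.+-suc (M ℕ.* p) r)) p∣) (ℕ.n∣m*n M)))

  φ-p^suc : ∀ k → φ (p ^ suc k) ≡ q ℕ.* p ^ k
  φ-p^suc k = begin
    count (p ^ suc k) (p ^ suc k)          ≡⟨ cong (count (p ^ suc k))
                                                   (trans (ℕ.*-comm p (p ^ k)) (sym (ℕ.+-identityʳ _))) ⟩
    count (p ^ suc k) (p ^ k ℕ.* p ℕ.+ 0)  ≡⟨ count-p^suc k (p ^ k) 0 ℕ.z≤n ⟩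
    p ^ k ℕ.* q ℕ.+ 0                      ≡⟨ trans (ℕ.+-identityʳ _) (ℕ.*-comm (p ^ k) q) ⟩
    q ℕ.* p ^ k                            ∎
    where open ≡-Reasoning

  φ-p^suc≢0 : ∀ k → ℕ.NonZero (φ (p ^ suc k))
  φ-p^suc≢0 k = subst ℕ.NonZero (sym (φ-p^suc k)) (ℕ.m*n≢0 q (p ^ k) {{q≢0}} {{ℕ.m^n≢0 p k}})
    where
    q≢0 : ℕ.NonZero q
    q≢0 = ℕ.>-nonZero (ℕ.≤-pred (ℕ.nonTrivial⇒n>1 p {{prime⇒nonTrivial p-prime}}))

-- Exponents and multiplicative orders

+≋+⇒∣∸ : ∀ {n e f} → + e ≋ + f [mod n ] → e ≤ f → n ℕ.∣ f ∸ e
+≋+⇒∣∸ {n} {e} {f} (mk≋ d) e≤f =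
  subst (n ℕ.∣_) (trans (cong ℤ.∣_∣ (ℤ.m-n≡m⊖n e f)) (ℤ.∣⊖∣-≤ e≤f)) d

∣∸⇒+≋+ : ∀ {n e f} → n ℕ.∣ f ∸ e → e ≤ f → + f ≋ + e [mod n ]
∣∸⇒+≋+ {n} {e} {f} d e≤f =
  mk≋ (subst (λ z → n ℕ.∣ ℤ.∣ z ∣) (sym (trans (ℤ.m-n≡m⊖n f e) (ℤ.⊖-≥ e≤f))) d)

+%≋+ : ∀ e n .{{_ : ℕ.NonZero n}} → + (e % n) ≋ + e [mod n ]
+%≋+ e n = ≋-sym (∣∸⇒+≋+ (ℕ.divides (e / n) e∸e%n≡) (m%n≤m e n))
  where
  e∸e%n≡ : e ∸ e % n ≡ e / n ℕ.* n
  e∸e%n≡ = trans (cong (_∸ e % n) (m≡m%n+[m/n]*n e n)) (ℕ.m+n∸m≡n (e % n) _)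

module _ {n N : ℕ} {x : ℤ} (x^N≋1 : x ℤ.^ N ≋ + 1 [mod n ]) where

  private
    exponent-≋-≤ : ∀ {e f} → N ℕ.∣ f ∸ e → e ≤ f → x ℤ.^ f ≋ x ℤ.^ e [mod n ]
    exponent-≋-≤ {e} {f} N∣f∸e e≤f = begin
      x ℤ.^ f                     ≡⟨ cong (x ℤ.^_) (sym (ℕ.m+[n∸m]≡n e≤f)) ⟩
      x ℤ.^ (e ℕ.+ (f ∸ e))       ≡⟨ ℤ.^-distribˡ-+-* x e (f ∸ e) ⟩
      x ℤ.^ e * x ℤ.^ (f ∸ e)     ≡⟨ cong (λ d → x ℤ.^ e * x ℤ.^ d)
                                          (trans (ℕ._∣_.equality N∣f∸e) (ℕ.*-comm t N)) ⟩
      x ℤ.^ e * x ℤ.^ (N ℕ.* t)   ≡⟨ cong (x ℤ.^ e *_) (sym (ℤ.^-*-assoc x N t)) ⟩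
      x ℤ.^ e * (x ℤ.^ N) ℤ.^ t   ≈⟨ ≋-* (≋-refl {x = x ℤ.^ e}) (≋-^ t x^N≋1) ⟩
      x ℤ.^ e * (+ 1) ℤ.^ t       ≡⟨ trans (cong (x ℤ.^ e *_) (ℤ.^-zeroˡ t)) (ℤ.*-identityʳ (x ℤ.^ e)) ⟩
      x ℤ.^ e                     ∎
      where
      open ≋-Reasoning n
      t = ℕ._∣_.quotient N∣f∸e

  exponent-≋ : ∀ {e f} → + e ≋ + f [mod N ] → x ℤ.^ e ≋ x ℤ.^ f [mod n ]
  exponent-≋ {e} {f} e≋f with ℕ.≤-total e f
  ... | inj₁ e≤f = ≋-sym (exponent-≋-≤ (+≋+⇒∣∸ e≋f e≤f) e≤f)
  ... | inj₂ f≤e = exponent-≋-≤ (+≋+⇒∣∸ (≋-sym e≋f) f≤e) f≤e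

  minimal-exponent⇒∣ : .{{_ : ℕ.NonZero N}} → (∀ m → 0 < m → x ℤ.^ m ≋ + 1 [mod n ] → N ≤ m) →
                       ∀ e → x ℤ.^ e ≋ + 1 [mod n ] → N ℕ.∣ e
  minimal-exponent⇒∣ minimal e x^e≋1 with e % N in r≡
  ... | zero  = ℕ.m%n≡0⇒n∣m e N r≡
  ... | suc r = ⊥-elim (ℕ.<⇒≱ (subst (_< N) r≡ (m%n<n e N)) (minimal (suc r) (ℕ.s≤s ℕ.z≤n) x^r≋1))
    where
    x^r≋1 : x ℤ.^ suc r ≋ + 1 [mod n ]
    x^r≋1 = ≋-trans (exponent-≋ (subst (λ r → + r ≋ + e [mod N ]) r≡ (+%≋+ e N))) x^e≋1

module _ {p : ℕ} (p-prime : Prime p) where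

  ∤-^ : ∀ x e → ¬ (+ p ∣ x) → ¬ (+ p ∣ x ℤ.^ e)
  ∤-^ x zero    p∤x p∣1 = ℕ.nonTrivial⇒≢1 {{prime⇒nonTrivial p-prime}} (ℕ.∣1⇒≡1 p∣1)
  ∤-^ x (suc e) p∤x p∣x^[1+e] = [ p∤x , ∤-^ x e p∤x ]′ (prime∣*⇒∣⊎∣ p-prime x (x ℤ.^ e) p∣x^[1+e])

  *-cancelˡ-≋ : ∀ K x {y z} → ¬ (+ p ∣ x) → x * y ≋ x * z [mod p ^ K ] → y ≋ z [mod p ^ K ]
  *-cancelˡ-≋ K x {y} {z} p∤x (mk≋ d) =
    mk≋ (ℤ.coprime-divisor (+ (p ^ K)) x (y - z) p^K⊥x (subst (+ (p ^ K) ∣_) (factor x y z) d))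
    where
    p^K⊥x : ℤ.Coprime (+ (p ^ K)) x
    p^K⊥x = Coprime.sym (∤⇒coprime-p^ p-prime K p∤x)
    factor : ∀ x y z → x * y - x * z ≡ x * (y - z)
    factor = solve-∀

  ^≋^⇒^∸≋1 : ∀ K {x e f} → ¬ (+ p ∣ x) → x ℤ.^ e ≋ x ℤ.^ f [mod p ^ K ] → e ≤ f →
             x ℤ.^ (f ∸ e) ≋ + 1 [mod p ^ K ]
  ^≋^⇒^∸≋1 K {x} {e} {f} p∤x x^e≋x^f e≤f = *-cancelˡ-≋ K (x ℤ.^ e) (∤-^ x e p∤x) (begin
    x ℤ.^ e * x ℤ.^ (f ∸ e)  ≡⟨ sym (ℤ.^-distribˡ-+-* x e (f ∸ e)) ⟩
    x ℤ.^ (e ℕ.+ (f ∸ e))    ≡⟨ cong (x ℤ.^_) (ℕ.m+[n∸m]≡n e≤f) ⟩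
    x ℤ.^ f                  ≈⟨ ≋-sym x^e≋x^f ⟩
    x ℤ.^ e                  ≡⟨ sym (ℤ.*-identityʳ (x ℤ.^ e)) ⟩
    x ℤ.^ e * + 1            ∎)
    where open ≋-Reasoning (p ^ K)

  order⇒pow-injective : ∀ K {x N} → ¬ (+ p ∣ x) → (∀ e → x ℤ.^ e ≋ + 1 [mod p ^ K ] → N ℕ.∣ e) →
                        ∀ {e f} → x ℤ.^ e ≋ x ℤ.^ f [mod p ^ K ] → + e ≋ + f [mod N ]
  order⇒pow-injective K p∤x order∣ {e} {f} x^e≋x^f with ℕ.≤-total e f
  ... | inj₁ e≤f = ≋-sym (∣∸⇒+≋+ (order∣ (f ∸ e) (^≋^⇒^∸≋1 K p∤x x^e≋x^f e≤f)) e≤f)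
  ... | inj₂ f≤e = ∣∸⇒+≋+ (order∣ (e ∸ f) (^≋^⇒^∸≋1 K p∤x (≋-sym x^e≋x^f) f≤e)) f≤e

module _ {q : ℕ} (p-prime : Prime (suc q)) where

  private
    p : ℕ
    p = suc q

  euler : ∀ k {x} → ¬ (+ p ∣ x) → x ℤ.^ φ (p ^ suc k) ≋ + 1 [mod p ^ suc k ]
  euler k {x} p∤x = subst (λ e → x ℤ.^ e ≋ + 1 [mod p ^ suc k ]) (sym (φ-p^suc p-prime k)) (euler′ k)
    where
    euler′ : ∀ k → x ℤ.^ (q ℕ.* p ^ k) ≋ + 1 [mod p ^ suc k ]
    euler′ zero    = subst₂ (λ e n → x ℤ.^ e ≋ + 1 [mod n ]) (sym (ℕ.*-identityʳ q)) (sym (ℕ.*-identityʳ p))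
                       (fermat-unit p-prime x p∤x)
    euler′ (suc k) = subst (λ z → z ≋ + 1 [mod p ^ suc (suc k) ])
                       (trans (ℤ.^-*-assoc x (q ℕ.* p ^ k) p) (cong (x ℤ.^_) (reassoc q p (p ^ k))))
                       (lift-≋1 p k (euler′ k))
      where
      reassoc : ∀ q p r → q ℕ.* r ℕ.* p ≡ q ℕ.* (p ℕ.* r)
      reassoc = ℕ-Solver.solve-∀

  module _ {g : ℤ} (g-primitive : IsPrimitiveRoot g (p ^ 2)) where

    primitive-root-∤ : ¬ (+ p ∣ g)
    primitive-root-∤ = coprime-p^suc⇒∤ p-prime 1 (proj₁ g-primitive)

    primitive-root-order∣ : ∀ e → g ℤ.^ e ≋ + 1 [mod p ^ 2 ] → φ (p ^ 2) ℕ.∣ e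
    primitive-root-order∣ = minimal-exponent⇒∣ (mk≋ (proj₁ (proj₂ g-primitive))) {{φ-p^suc≢0 p-prime 1}}
      (λ m 0<m g^m≋1 → proj₂ (proj₂ g-primitive) m 0<m (divides g^m≋1))

    primitive-root-order-mod-p : ∀ {x} → x ≋ g [mod p ^ 1 ] → ∀ e → x ℤ.^ e ≋ + 1 [mod p ^ 1 ] → q ℕ.∣ e
    primitive-root-order-mod-p {x} x≋g e x^e≋1 = ℕ.*-cancelʳ-∣ p (subst₂ ℕ._∣_ φ[p²]≡qp refl φ[p²]∣ep)
      where
      g^e≋1 : g ℤ.^ e ≋ + 1 [mod p ^ 1 ]
      g^e≋1 = ≋-trans (≋-^ e (≋-sym x≋g)) x^e≋1
      φ[p²]∣ep : φ (p ^ 2) ℕ.∣ e ℕ.* p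
      φ[p²]∣ep = primitive-root-order∣ (e ℕ.* p)
        (subst (λ z → z ≋ + 1 [mod p ^ 2 ]) (ℤ.^-*-assoc g e p) (lift-≋1 p 0 g^e≋1))
      φ[p²]≡qp : φ (p ^ 2) ≡ q ℕ.* p
      φ[p²]≡qp = trans (φ-p^suc p-prime 1) (cong (q ℕ.*_) (ℕ.*-identityʳ p))

    -- x^q ≡ 1 (mod p) by Fermat but not modulo p², since φ(p²) = q·p > q; lift-exact
    -- then pins the order of x^q modulo p^(k+1) down to p^k.
    primitive-root-order : p ≢ 2 → ∀ {x} → x ≋ g [mod p ^ 2 ] →
                           ∀ k e → x ℤ.^ e ≋ + 1 [mod p ^ suc k ] → φ (p ^ suc k) ℕ.∣ e
    primitive-root-order p≢2 {x} x≋g k e x^e≋1 =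
      subst₂ ℕ._∣_ (sym (φ-p^suc p-prime k)) (trans (ℕ.*-comm q m) (sym e≡mq)) (ℕ.*-monoʳ-∣ q p^k∣m)
      where
      p^1∣p^[1+k] : ∀ k → p ^ 1 ℕ.∣ p ^ suc k
      p^1∣p^[1+k] k = ^-monoʳ-∣ p {1} {suc k} (ℕ.s≤s ℕ.z≤n)
      q∣e = primitive-root-order-mod-p (≋-weaken (p^1∣p^[1+k] 1) x≋g) e (≋-weaken (p^1∣p^[1+k] k) x^e≋1)
      m = ℕ._∣_.quotient q∣e
      e≡mq = ℕ._∣_.equality q∣e
      p∤x : ¬ (+ p ∣ x)
      p∤x = ≋-∤ 1 (≋-sym x≋g) primitive-root-∤
      y = x ℤ.^ q
      y≋1 : y ≋ + 1 [mod p ^ 1 ]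
      y≋1 = ≋-weaken (ℕ.∣-reflexive (ℕ.*-identityʳ p)) (fermat-unit p-prime x p∤x)
      y≉1 : ¬ (y ≋ + 1 [mod p ^ 2 ])
      y≉1 y≋1 = ℕ.<⇒≱ (ℕ.m<m*n q (p ^ 1) (subst (1 <_) (sym (ℕ.*-identityʳ p)) 1<p))
        (subst (ℕ._≤ q) (φ-p^suc p-prime 1) (proj₂ (proj₂ g-primitive) q (ℕ.>-nonZero⁻¹ q)
          (divides (≋-trans (≋-^ q (≋-sym x≋g)) y≋1))))
        where
        1<p : 1 < p
        1<p = ℕ.nonTrivial⇒n>1 p {{prime⇒nonTrivial p-prime}}
        instance
          q≢0 : ℕ.NonZero q
          q≢0 = ℕ.>-nonZero (ℕ.≤-pred 1<p)
      y^m≋1 : y ℤ.^ m ≋ + 1 [mod p ^ (k ℕ.+ 1) ]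
      y^m≋1 = subst₂ (λ z n → z ≋ + 1 [mod p ^ n ])
        (sym (trans (ℤ.^-*-assoc x q m) (cong (x ℤ.^_) (trans (ℕ.*-comm q m) (sym e≡mq)))))
        (ℕ.+-comm 1 k) x^e≋1
      p^k∣m : p ^ k ℕ.∣ m
      p^k∣m = exact⇒p^j∣exponent p-prime p≢2 k 0 m (y≋1 , y≉1) y^m≋1

-- Counting units modulo a prime power

⊎-injective⇒≤ : ∀ {a b c} (f : Fin a ⊎ Fin b → Fin c) → (∀ {i j} → f i ≡ f j → i ≡ j) → a ℕ.+ b ≤ c
⊎-injective⇒≤ {a} {b} f f-injective = Fin.injective⇒≤ {f = f ∘ splitAt a} λ {i} {j} eq →
  trans (sym (Fin.join-splitAt a b i)) (trans (cong (join a b) (f-injective eq)) (Fin.join-splitAt a b j))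

injective-⊎⇒≤ : ∀ {a b c} (f : Fin c → Fin a ⊎ Fin b) → (∀ {i j} → f i ≡ f j → i ≡ j) → c ≤ a ℕ.+ b
injective-⊎⇒≤ {a} {b} f f-injective = Fin.injective⇒≤ {f = join a b ∘ f} λ {i} {j} eq →
  f-injective (trans (sym (Fin.splitAt-join a b (f i))) (trans (cong (splitAt a) eq) (Fin.splitAt-join a b (f j))))

multiple<⇒≡0 : ∀ {n m} → n ℕ.∣ m → m < n → m ≡ 0
multiple<⇒≡0 {m = zero}  _   _   = refl
multiple<⇒≡0 {m = suc m} n∣m m<n = ⊥-elim (ℕ.<⇒≱ m<n (ℕ.∣⇒≤ n∣m))

private
  ≤∧+≋+⇒≡ : ∀ {n i j} → + i ≋ + j [mod n ] → i ≤ j → j < n → i ≡ j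
  ≤∧+≋+⇒≡ {i = i} {j} i≋j i≤j j<n =
    ℕ.≤-antisym i≤j (ℕ.m∸n≡0⇒m≤n (multiple<⇒≡0 (+≋+⇒∣∸ i≋j i≤j) j∸i<n))
    where
    j∸i<n = ℕ.≤-<-trans (ℕ.m∸n≤m j i) j<n

+≋+⇒≡ : ∀ {n i j} → + i ≋ + j [mod n ] → i < n → j < n → i ≡ j
+≋+⇒≡ {i = i} {j} i≋j i<n j<n with ℕ.≤-total i j
... | inj₁ i≤j = ≤∧+≋+⇒≡ i≋j i≤j j<n
... | inj₂ j≤i = sym (≤∧+≋+⇒≡ (≋-sym i≋j) j≤i i<n)

-- Modulo M = p^(k+1), the φ M units and the p^k multiples p·j of p together fill all M residues.
module _ {q : ℕ} (p-prime : Prime (suc q)) (k : ℕ) where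

  private
    p M : ℕ
    p = suc q
    M = p ^ suc k
    instance
      M≢0 : ℕ.NonZero M
      M≢0 = ℕ.m^n≢0 p (suc k)

    M≡φ+p^k : M ≡ φ M ℕ.+ p ^ k
    M≡φ+p^k = trans (ℕ.+-comm (p ^ k) (q ℕ.* p ^ k)) (cong (ℕ._+ p ^ k) (sym (φ-p^suc p-prime k)))

    residue : ℤ → Fin M
    residue x = fromℕ< (modN< x M)

    residue-≋ : ∀ {x y} → residue x ≡ residue y → x ≋ y [mod M ]
    residue-≋ {x} {y} eq = ≋-trans (≋-modN x M) (≋-trans (≋-reflexive (cong +_ modN≡)) (≋-sym (≋-modN y M)))
      where
      modN≡ : x modN M ≡ y modN M
      modN≡ = trans (sym (Fin.toℕ-fromℕ< _)) (trans (cong toℕ eq) (Fin.toℕ-fromℕ< _))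

    p∣residue⇒p∣ : ∀ x → p ℕ.∣ toℕ (residue x) → + p ∣ x
    p∣residue⇒p∣ x p∣r = ≋-∣ (ℕ.m∣m*n (p ^ k)) (≋-modN x M) (subst (p ℕ.∣_) (Fin.toℕ-fromℕ< _) p∣r)

  units-injection-bound : ∀ {n} (g : Fin n → ℤ) → (∀ i → ¬ (+ p ∣ g i)) →
                          (∀ {i j} → g i ≋ g j [mod M ] → i ≡ j) → n ≤ φ M
  units-injection-bound {n} g units g-injective =
    ℕ.+-cancelʳ-≤ (p ^ k) n (φ M) (subst (n ℕ.+ p ^ k ≤_) M≡φ+p^k (⊎-injective⇒≤ f f-injective))
    where
    f : Fin n ⊎ Fin (p ^ k) → Fin M
    f (inj₁ i) = residue (g i)
    f (inj₂ j) = fromℕ< (ℕ.*-monoʳ-< p (Fin.toℕ<n j))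
    unit≢multiple : ∀ i j → f (inj₁ i) ≡ f (inj₂ j) → ⊥
    unit≢multiple i j eq = units i (p∣residue⇒p∣ (g i) (ℕ.divides (toℕ j)
      (trans (cong toℕ eq) (trans (Fin.toℕ-fromℕ< _) (ℕ.*-comm p (toℕ j))))))
    f-injective : ∀ {i j} → f i ≡ f j → i ≡ j
    f-injective {inj₁ i} {inj₁ j} eq = cong inj₁ (g-injective (residue-≋ eq))
    f-injective {inj₁ i} {inj₂ j} eq = ⊥-elim (unit≢multiple i j eq)
    f-injective {inj₂ i} {inj₁ j} eq = ⊥-elim (unit≢multiple j i (sym eq))
    f-injective {inj₂ i} {inj₂ j} eq = cong inj₂ (Fin.toℕ-injective (ℕ.*-cancelˡ-≡ _ _ p
      (trans (sym (Fin.toℕ-fromℕ< _)) (trans (cong toℕ eq) (Fin.toℕ-fromℕ< _)))))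

  units-covered : (g : Fin (φ M) → ℤ) → (∀ i → ¬ (+ p ∣ g i)) → (∀ {i j} → g i ≋ g j [mod M ] → i ≡ j) →
                  ∀ x → ¬ (+ p ∣ x) → ∃ λ i → g i ≋ x [mod M ]
  units-covered g units g-injective x p∤x with Fin.any? (λ i → ≋? (g i) x)
  ... | yes covered  = covered
  ... | no uncovered = ⊥-elim (ℕ.n≮n (φ M) (units-injection-bound (x ∷ g) units′ injective′))
    where
    units′ : ∀ i → ¬ (+ p ∣ (x ∷ g) i)
    units′ Fin.zero    = p∤x
    units′ (Fin.suc i) = units i
    injective′ : ∀ {i j} → (x ∷ g) i ≋ (x ∷ g) j [mod M ] → i ≡ j
    injective′ {Fin.zero}  {Fin.zero}  _   = refl
    injective′ {Fin.zero}  {Fin.suc j} x≋g = ⊥-elim (uncovered (j , ≋-sym x≋g))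
    injective′ {Fin.suc i} {Fin.zero}  g≋x = ⊥-elim (uncovered (i , g≋x))
    injective′ {Fin.suc i} {Fin.suc j} g≋g = cong Fin.suc (g-injective g≋g)

  units-cover-bound : ∀ {n} (g : Fin n → ℤ) → (∀ x → ¬ (+ p ∣ x) → ∃ λ i → g i ≋ x [mod M ]) → φ M ≤ n
  units-cover-bound {n} g cover =
    ℕ.+-cancelʳ-≤ (p ^ k) (φ M) n (subst (_≤ n ℕ.+ p ^ k) M≡φ+p^k (injective-⊎⇒≤ f f-injective))
    where
    classify : (r : Fin M) → Dec (p ℕ.∣ toℕ r) → Fin n ⊎ Fin (p ^ k)
    classify r (yes _)  = inj₂ (fromℕ< (m<n*o⇒m/o<n (subst (toℕ r <_) (ℕ.*-comm p (p ^ k)) (Fin.toℕ<n r))))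
    classify r (no p∤r) = inj₁ (proj₁ (cover (+ toℕ r) p∤r))
    f : Fin M → Fin n ⊎ Fin (p ^ k)
    f r = classify r (p ℕ.∣? toℕ r)
    classify-injective : ∀ r s dr ds → classify r dr ≡ classify s ds → r ≡ s
    classify-injective r s (yes p∣r) (yes p∣s) eq = Fin.toℕ-injective (begin
      toℕ r            ≡⟨ sym (m/n*n≡m p∣r) ⟩
      toℕ r / p ℕ.* p  ≡⟨ cong (ℕ._* p) r/p≡s/p ⟩
      toℕ s / p ℕ.* p  ≡⟨ m/n*n≡m p∣s ⟩
      toℕ s            ∎)
      where
      open ≡-Reasoning
      r/p≡s/p : toℕ r / p ≡ toℕ s / p
      r/p≡s/p = trans (sym (Fin.toℕ-fromℕ< _)) (trans (cong toℕ (inj₂-injective eq)) (Fin.toℕ-fromℕ< _))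
    classify-injective r s (no p∤r)  (no p∤s)  eq = Fin.toℕ-injective (+≋+⇒≡ r≋s (Fin.toℕ<n r) (Fin.toℕ<n s))
      where
      r≋s : + toℕ r ≋ + toℕ s [mod M ]
      r≋s = ≋-trans (≋-sym (proj₂ (cover (+ toℕ r) p∤r)))
              (≋-trans (≋-reflexive (cong g (inj₁-injective eq))) (proj₂ (cover (+ toℕ s) p∤s)))
    f-injective : ∀ {r s} → f r ≡ f s → r ≡ s
    f-injective {r} {s} = classify-injective r s (p ℕ.∣? toℕ r) (p ℕ.∣? toℕ s)

-- The exponentiation map α ↦ a^α

module _ (p : ℕ) where

  IsZp⇒≋ : ∀ s → IsZp p s → ∀ {j k} → j ≤ k → s (suc k) ≋ s (suc j) [mod p ^ suc j ]
  IsZp⇒≋ s s∈ℤp {j} {k} j≤k =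
    subst (λ i → s (suc i) ≋ s (suc j) [mod p ^ suc j ]) (ℕ.m∸n+n≡m j≤k) (shifted (k ∸ j))
    where
    shifted : ∀ d → s (suc (d ℕ.+ j)) ≋ s (suc j) [mod p ^ suc j ]
    shifted zero    = ≋-refl
    shifted (suc d) = ≋-trans (≋-weaken (^-monoʳ-∣ p (ℕ.s≤s (ℕ.m≤n+m j d))) (mk≋ (s∈ℤp (d ℕ.+ j)))) (shifted d)

  IsUnitZp⇒∤ : ∀ u → IsUnitZp p u → ∀ k → ¬ (+ p ∣ u (suc k))
  IsUnitZp⇒∤ u (u∈ℤp , p∤u₁) k = ≋-∤ 0 (≋-sym (IsZp⇒≋ u u∈ℤp ℕ.z≤n)) p∤u₁

module Exponentiation {q : ℕ} (p-prime : Prime (suc q)) (a : Seq) (a-unit : IsUnitZp (suc q) a) where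

  private
    p : ℕ
    p = suc q
    Φ : ℕ → ℕ
    Φ k = φ (p ^ suc k)
    Φ≢0 : ∀ k → ℕ.NonZero (Φ k)
    Φ≢0 = φ-p^suc≢0 p-prime
    a∈ℤp : IsZp p a
    a∈ℤp = proj₁ a-unit

  a^Φ≋1 : ∀ k → a (suc k) ℤ.^ Φ k ≋ + 1 [mod p ^ suc k ]
  a^Φ≋1 k = euler p-prime k (IsUnitZp⇒∤ p a a-unit k)

  Φ∣Φ-suc : ∀ k → Φ k ℕ.∣ Φ (suc k)
  Φ∣Φ-suc k = subst₂ ℕ._∣_ (sym (φ-p^suc p-prime k)) (sym (φ-p^suc p-prime (suc k)))
    (ℕ.*-monoʳ-∣ q (^-monoʳ-∣ p (ℕ.n≤1+n k)))

  ≋-modΦ : ∀ k s → s ≋ + (s modN Φ k) [mod Φ k ]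
  ≋-modΦ k s = ≋-modN s (Φ k) {{Φ≢0 k}}

  pow-isUnit : (α : Seq) → IsEp p α → IsUnitZp p (pow p a α)
  pow-isUnit α α∈Ep = (λ k → divides (pow-coherent k)) , ∤-^ p-prime (a 1) (α 1 modN Φ 0) (IsUnitZp⇒∤ p a a-unit 0)
    where
    pow-coherent : ∀ k → pow p a α (suc (suc k)) ≋ pow p a α (suc k) [mod p ^ suc k ]
    pow-coherent k = ≋-trans (≋-^ E′ (mk≋ (a∈ℤp k))) (exponent-≋ (a^Φ≋1 k) E′≋E)
      where
      E′ = α (suc (suc k)) modN Φ (suc k)
      E′≋E : + E′ ≋ + (α (suc k) modN Φ k) [mod Φ k ]
      E′≋E = ≋-trans (≋-weaken (Φ∣Φ-suc k) (≋-sym (≋-modΦ (suc k) (α (suc (suc k))))))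
               (≋-trans (mk≋ (α∈Ep k)) (≋-modΦ k (α (suc k))))

  pow-cong : (α β : Seq) → IsEp p α → IsEp p β → α ≈E[ p ] β → pow p a α ≈Z[ p ] pow p a β
  pow-cong α β _ _ α≈β k = divides (exponent-≋ (a^Φ≋1 k)
    (≋-trans (≋-sym (≋-modΦ k (α (suc k)))) (≋-trans (mk≋ (α≈β k)) (≋-modΦ k (β (suc k))))))

  pow-homo : (α β : Seq) → IsEp p α → IsEp p β → pow p a (α ⊕ β) ≈Z[ p ] (pow p a α ⊗ pow p a β)
  pow-homo α β _ _ k = divides (begin
    x ℤ.^ ((α (suc k) + β (suc k)) modN Φ k)  ≈⟨ exponent-≋ (a^Φ≋1 k) E≋E₁+E₂ ⟩
    x ℤ.^ (E₁ ℕ.+ E₂)                         ≡⟨ ℤ.^-distribˡ-+-* x E₁ E₂ ⟩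
    x ℤ.^ E₁ * x ℤ.^ E₂                       ∎)
    where
    open ≋-Reasoning (p ^ suc k)
    x = a (suc k)
    E₁ = α (suc k) modN Φ k
    E₂ = β (suc k) modN Φ k
    E≋E₁+E₂ : + ((α (suc k) + β (suc k)) modN Φ k) ≋ + (E₁ ℕ.+ E₂) [mod Φ k ]
    E≋E₁+E₂ = ≋-trans (≋-sym (≋-modΦ k (α (suc k) + β (suc k))))
                      (≋-+ (≋-modΦ k (α (suc k))) (≋-modΦ k (β (suc k))))

  module _ (p≢2 : p ≢ 2) (a₂-primitive : IsPrimitiveRoot (a 2) (p ^ 2)) where

    -- a₁ is only known to agree with a₂ modulo p.
    a-order : ∀ k e → a (suc k) ℤ.^ e ≋ + 1 [mod p ^ suc k ] → Φ k ℕ.∣ e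
    a-order zero    e a₁^e≋1 = subst (ℕ._∣ e) (sym Φ0≡q)
      (primitive-root-order-mod-p p-prime a₂-primitive (≋-sym (mk≋ (a∈ℤp 0))) e a₁^e≋1)
      where
      Φ0≡q : Φ 0 ≡ q
      Φ0≡q = trans (φ-p^suc p-prime 0) (ℕ.*-identityʳ q)
    a-order (suc k) = primitive-root-order p-prime a₂-primitive p≢2 (IsZp⇒≋ p a a∈ℤp (ℕ.s≤s ℕ.z≤n)) (suc k)

    a^-injective : ∀ k {e f} → a (suc k) ℤ.^ e ≋ a (suc k) ℤ.^ f [mod p ^ suc k ] → + e ≋ + f [mod Φ k ]
    a^-injective k = order⇒pow-injective p-prime (suc k) (IsUnitZp⇒∤ p a a-unit k) (a-order k)

    pow-injective : (α β : Seq) → IsEp p α → IsEp p β → pow p a α ≈Z[ p ] pow p a β → α ≈E[ p ] β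
    pow-injective α β _ _ pow-α≈pow-β k = divides (≋-trans (≋-modΦ k (α (suc k)))
      (≋-trans (a^-injective k (mk≋ (pow-α≈pow-β k))) (≋-sym (≋-modΦ k (β (suc k))))))

    pow-surjective : (u : Seq) → IsUnitZp p u → Σ Seq (λ α → IsEp p α × pow p a α ≈Z[ p ] u)
    pow-surjective u u-unit = α , α∈Ep , pow-α≈u
      where
      log : ∀ k → ∃ λ (i : Fin (Φ k)) → a (suc k) ℤ.^ toℕ i ≋ u (suc k) [mod p ^ suc k ]
      log k = units-covered p-prime k (λ i → a (suc k) ℤ.^ toℕ i)
        (λ i → ∤-^ p-prime (a (suc k)) (toℕ i) (IsUnitZp⇒∤ p a a-unit k))
        (λ {i} {j} a^i≋a^j → Fin.toℕ-injective (+≋+⇒≡ (a^-injective k a^i≋a^j) (Fin.toℕ<n i) (Fin.toℕ<n j)))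
        (u (suc k)) (IsUnitZp⇒∤ p u u-unit k)
      e : ℕ → ℕ
      e k = toℕ (proj₁ (log k))
      α : Seq
      α zero    = + 0
      α (suc k) = + e k
      α∈Ep : IsEp p α
      α∈Ep k = divides (a^-injective k {e (suc k)} {e k} (begin
        a (suc k) ℤ.^ e (suc k)        ≈⟨ ≋-^ (e (suc k)) (≋-sym (mk≋ (a∈ℤp k))) ⟩
        a (suc (suc k)) ℤ.^ e (suc k)  ≈⟨ ≋-weaken (^-monoʳ-∣ p (ℕ.n≤1+n (suc k))) (proj₂ (log (suc k))) ⟩
        u (suc (suc k))                ≈⟨ mk≋ (proj₁ u-unit k) ⟩
        u (suc k)                      ≈⟨ ≋-sym (proj₂ (log k)) ⟩
        a (suc k) ℤ.^ e k              ∎))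
        where open ≋-Reasoning (p ^ suc k)
      pow-α≈u : pow p a α ≈Z[ p ] u
      pow-α≈u k = divides (≋-trans (exponent-≋ (a^Φ≋1 k) (≋-sym (≋-modΦ k (+ e k)))) (proj₂ (log k)))

  -- Surjectivity onto constant sequences writes every unit modulo p² as a₂^i with i < m.
  pow-surjective⇒primitiveRoot : ((u : Seq) → IsUnitZp p u → Σ Seq (λ α → IsEp p α × pow p a α ≈Z[ p ] u)) →
                                 IsPrimitiveRoot (a 2) (p ^ 2)
  pow-surjective⇒primitiveRoot surjective = ∤⇒coprime-p^ p-prime 2 (IsUnitZp⇒∤ p a a-unit 1) , divides (a^Φ≋1 1) , minimal
    where
    minimal : ∀ m → 0 < m → a 2 ℤ.^ m ≡ + 1 [mod p ^ 2 ] → φ (p ^ 2) ≤ m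
    minimal m 0<m a₂^m≡1 = units-cover-bound p-prime 1 (λ (i : Fin m) → a 2 ℤ.^ toℕ i) cover
      where
      instance
        m≢0 : ℕ.NonZero m
        m≢0 = ℕ.>-nonZero 0<m
      cover : ∀ x → ¬ (+ p ∣ x) → ∃ λ (i : Fin m) → a 2 ℤ.^ toℕ i ≋ x [mod p ^ 2 ]
      cover x p∤x = fromℕ< (m%n<n E m) , (begin
        a 2 ℤ.^ toℕ (fromℕ< (m%n<n E m))  ≡⟨ cong (a 2 ℤ.^_) (Fin.toℕ-fromℕ< (m%n<n E m)) ⟩
        a 2 ℤ.^ (E % m)                   ≈⟨ exponent-≋ (mk≋ a₂^m≡1) (+%≋+ E m) ⟩
        a 2 ℤ.^ E                         ≈⟨ mk≋ (proj₂ (proj₂ preimage) 1) ⟩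
        x                                 ∎)
        where
        open ≋-Reasoning (p ^ 2)
        preimage = surjective (λ _ → x) ((λ _ → divides (≋-refl {x = x})) , p∤x)
        E = proj₁ preimage 2 modN Φ 1

lemma2p4 : (p : ℕ) → Prime p → p ≢ 2 → (a : Seq) → IsUnitZp p a →
    -- α ↦ a^α is a well-defined map 𝓔_p → ℤ_p^×
    ((α : Seq) → IsEp p α → IsUnitZp p (pow p a α)) ×
    ((α β : Seq) → IsEp p α → IsEp p β → α ≈E[ p ] β → pow p a α ≈Z[ p ] pow p a β) ×
    -- it is a homomorphism (𝓔_p , +) → (ℤ_p^× , ·)
    ((α β : Seq) → IsEp p α → IsEp p β →
      pow p a (α ⊕ β) ≈Z[ p ] (pow p a α ⊗ pow p a β)) ×
    -- it is bijective on classes iff a_2 is a primitive root mod p^2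
    ((((α β : Seq) → IsEp p α → IsEp p β → pow p a α ≈Z[ p ] pow p a β → α ≈E[ p ] β) ×
      ((u : Seq) → IsUnitZp p u → Σ Seq (λ α → IsEp p α × pow p a α ≈Z[ p ] u)))
     ⇔ IsPrimitiveRoot (a 2) (p ^ 2))
lemma2p4 zero    p-prime = ⊥-elim (ℕ.≢-nonZero⁻¹ 0 {{prime⇒nonZero p-prime}} refl)
lemma2p4 (suc q) p-prime p≢2 a a-unit =
  pow-isUnit , pow-cong , pow-homo ,
  mk⇔ (λ (_ , surjective) → pow-surjective⇒primitiveRoot surjective)
      (λ a₂-primitive → pow-injective p≢2 a₂-primitive , pow-surjective p≢2 a₂-primitive)
  where open Exponentiation p-prime a a-unit
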